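{- If $P$ and $Q$ are both $\mathbf{R}$-healthy, then $P \,;\, Q$ is $\mathbf{R}$-healthy.
   Context: Fix a trace algebra $(\mathcal{T}, \frown, \langle\rangle)$: a set with associative $\frown$, two-sided unit $\langle\rangle$, left and right cancellation, and $x \frown y = \langle\rangle \Rightarrow x = \langle\rangle$. Prefix: $x \le y \iff \exists z.\ y = x \frown z$; subtraction: $y - x$ is the unique $z$ with $y = x \frown z$ if $x \le y$, else $\langle\rangle$. Predicates are relations (formulas identified up to logical equivalence) over unprimed variables $v$ and primed variables $v'$, including $wait, wait' : \mathbb{B}$, $tr, tr' : \mathcal{T}$ and other state variables. Sequential composition: $P \,;\, Q \triangleq \exists v_0.\ P[v_0/v'] \land Q[v_0/v]$. Conditional: $P \lhd b \rhd Q \triangleq (b \land P) \lor (\lnot b \land Q)$. $\mathit{II}$ is $v' = v$ for all variables. $\mathbf{R1}(P) \triangleq P \land tr \le tr'$; $\mathbf{R2}_c(P) \triangleq P[\langle\rangle, tr' - tr / tr, tr'] \lhd tr \le tr' \rhd P$; $\mathbf{R3}(P) \triangleq \mathit{II} \lhd wait \rhd P$; $\mathbf{R} \triangleq \mathbf{R3} \circ \mathbf{R2}_c \circ \mathbf{R1}$. $P$ is $\mathbf{R}$-healthy if $\mathbf{R}(P) = P$. -}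

module Defs where

open import Level using (Level; suc; _⊔_; Lift)
open import Data.Bool using (Bool; true; false; T)
open import Data.Product using (Σ; ∃; _×_; _,_)
open import Data.Sum using (_⊎_)
open import Relation.Nullary using (¬_)
open import Relation.Binary.PropositionalEquality using (_≡_)

-- Subtraction y - x is included as an operation, specified exactly by
-- the paper's definition: it is the (unique, by left cancellation) z with
-- y = x ⌢ z when x ≤ y, and ⟨⟩ otherwise.
record TraceAlgebra (ℓ : Level) : Set (suc ℓ) where
  infixr 6 _⌢_
  field
    Carrier : Set ℓ
    _⌢_     : Carrier → Carrier → Carrier
    ⟨⟩      : Carrier
    assoc   : ∀ x y z → (x ⌢ y) ⌢ z ≡ x ⌢ (y ⌢ z)
    identityˡ : ∀ x → ⟨⟩ ⌢ x ≡ x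
    identityʳ : ∀ x → x ⌢ ⟨⟩ ≡ x
    cancelˡ : ∀ x y z → x ⌢ y ≡ x ⌢ z → y ≡ z
    cancelʳ : ∀ x y z → y ⌢ x ≡ z ⌢ x → y ≡ z
    nonextendable : ∀ x y → x ⌢ y ≡ ⟨⟩ → x ≡ ⟨⟩

  _≼_ : Carrier → Carrier → Set ℓ
  x ≼ y = ∃ λ z → y ≡ x ⌢ z

  field
    _-_     : Carrier → Carrier → Carrier
    minus-≼ : ∀ x y → x ≼ y → y ≡ x ⌢ (y - x)
    minus-⋠ : ∀ x y → ¬ (x ≼ y) → y - x ≡ ⟨⟩

module Designs {ℓ : Level} (𝕋 : TraceAlgebra ℓ) (S : Set ℓ) where
  open TraceAlgebra 𝕋

  record State : Set ℓ where
    constructor ⟪_,_,_⟫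
    field
      wait : Bool
      tr   : Carrier
      st   : S
  open State public

  -- Predicates: relations between the unprimed (before) and primed (after) observations.
  Pred : Set (suc ℓ)
  Pred = State → State → Set ℓ

  _≐_ : Pred → Pred → Set ℓ
  P ≐ Q = ∀ s s' → (P s s' → Q s s') × (Q s s' → P s s')

  _⨾_ : Pred → Pred → Pred
  (P ⨾ Q) s s' = Σ State λ s₀ → P s s₀ × Q s₀ s'

  cond : Pred → (State → State → Set ℓ) → Pred → Pred
  cond P b Q s s' = (b s s' × P s s') ⊎ (¬ b s s' × Q s s')

  II : Pred
  II s s' = s' ≡ s

  R1 : Pred → Pred
  R1 P s s' = P s s' × (tr s ≼ tr s')

  R2c : Pred → Pred
  R2c P = cond (λ s s' → P (record s { tr = ⟨⟩ }) (record s' { tr = tr s' - tr s }))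
               (λ s s' → tr s ≼ tr s')
               P

  R3 : Pred → Pred
  R3 P = cond II (λ s s' → Lift ℓ (wait s ≡ true)) P

  R : Pred → Pred
  R P = R3 (R2c (R1 P))

  Healthy : Pred → Set ℓ
  Healthy P = R P ≐ P

-- A predicate P is R-healthy exactly when it is reactive: it never shortens the
-- trace, it is invariant under prefixing a common trace to both the before- and
-- after-trace, and from a waiting state it behaves as II.  Each of the three
-- properties is preserved by sequential composition: for the shift invariance,
-- trace monotonicity of the first component puts the intermediate trace
-- behind the common prefix, so the prefix can be stripped from it as well.
module Submission where

open import Level using (Level; lift)
open import Defs
open import Data.Bool using (true; false)
open import Data.Product using (∃; _×_; _,_; proj₁; proj₂)
open import Data.Sum using (inj₁; inj₂)
open import Data.Empty using (⊥-elim)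
open import Function.Bundles using (_⇔_; mk⇔; module Equivalence)
open Equivalence using (to; from)
open import Relation.Binary.PropositionalEquality
  using (_≡_; refl; sym; trans; cong; subst; subst₂)

module TraceAlgebraProperties {ℓ : Level} (𝕋 : TraceAlgebra ℓ) where
  open TraceAlgebra 𝕋

  ≼-refl : ∀ x → x ≼ x
  ≼-refl x = ⟨⟩ , sym (identityʳ x)

  ⟨⟩-≼ : ∀ x → ⟨⟩ ≼ x
  ⟨⟩-≼ x = x , sym (identityˡ x)

  ≼-⌢ : ∀ x y → x ≼ (x ⌢ y)
  ≼-⌢ x y = y , refl

  ≼-trans : ∀ {x y z} → x ≼ y → y ≼ z → x ≼ z
  ≼-trans {x} (a , refl) (b , refl) = a ⌢ b , assoc x a b

  ⌢-monoʳ-≼ : ∀ t {x y} → x ≼ y → (t ⌢ x) ≼ (t ⌢ y)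
  ⌢-monoʳ-≼ t {x} (a , refl) = a , sym (assoc t x a)

  ⌢-cancelˡ-≼ : ∀ t {x y} → (t ⌢ x) ≼ (t ⌢ y) → x ≼ y
  ⌢-cancelˡ-≼ t {x} {y} (a , e) = a , cancelˡ t y (x ⌢ a) (trans e (assoc t x a))

  minus-unique : ∀ {x y z} → y ≡ x ⌢ z → y - x ≡ z
  minus-unique {x} {y} {z} e =
    cancelˡ x (y - x) z (trans (sym (minus-≼ x y (z , e))) e)

  minus-⌢ˡ : ∀ t {x y} → x ≼ y → (t ⌢ y) - (t ⌢ x) ≡ y - x
  minus-⌢ˡ t {x} {y} (a , refl) =
    trans (minus-unique (sym (assoc t x a))) (sym (minus-unique refl))

module Reactive {ℓ : Level} (𝕋 : TraceAlgebra ℓ) (S : Set ℓ) where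
  open TraceAlgebra 𝕋
  open TraceAlgebraProperties 𝕋
  open Designs 𝕋 S

  shift : Carrier → State → State
  shift t s = record s { tr = t ⌢ tr s }

  shift-split : ∀ {t y} s → tr s ≡ t ⌢ y → shift t (record s { tr = y }) ≡ s
  shift-split s e = cong (λ u → record s { tr = u }) (sym e)

  shift-surjective : ∀ {t} s → t ≼ tr s → ∃ λ s₁ → s ≡ shift t s₁
  shift-surjective s (y , e) = record s { tr = y } , sym (shift-split s e)

  shift-injective : ∀ t {s s'} → shift t s ≡ shift t s' → s ≡ s'
  shift-injective t {⟪ w , u , x ⟫} {⟪ w' , u' , x' ⟫} e
    with cong wait e | cong st e
  ... | refl | refl = cong (λ v → ⟪ w , v , x ⟫) (cancelˡ t u u' (cong tr e))

  record IsReactive (P : Pred) : Set ℓ where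
    field
      trace-≼         : ∀ {s s'} → P s s' → tr s ≼ tr s'
      shift-invariant : ∀ t s s' → P (shift t s) (shift t s') ⇔ P s s'
      waiting-II      : ∀ {s s'} → wait s ≡ true → P s s' ⇔ II s s'

    strip-trace : ∀ {s s'} → tr s ≼ tr s' →
      P s s' ⇔ P (record s { tr = ⟨⟩ }) (record s' { tr = tr s' - tr s })
    strip-trace {s} {s'} le = mk⇔
      (λ p → to (shift-invariant (tr s) _ _) (subst₂ P (sym s≡) (sym s'≡) p))
      (λ p → subst₂ P s≡ s'≡ (from (shift-invariant (tr s) _ _) p))
      where
        s≡ : shift (tr s) (record s { tr = ⟨⟩ }) ≡ s
        s≡ = shift-split s (sym (identityʳ (tr s)))
        s'≡ : shift (tr s) (record s' { tr = tr s' - tr s }) ≡ s'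
        s'≡ = shift-split s' (minus-≼ (tr s) (tr s') le)

  module _ {P : Pred} (h : Healthy P) where
    private
      heal : ∀ {s s'} → P s s' → R P s s'
      heal = proj₂ (h _ _)

      unheal : ∀ {s s'} → R P s s' → P s s'
      unheal = proj₁ (h _ _)

    healthy-trace-≼ : ∀ {s s'} → P s s' → tr s ≼ tr s'
    healthy-trace-≼ p with heal p
    ... | inj₁ (_ , refl) = ≼-refl _
    ... | inj₂ (_ , inj₁ (le , _)) = le
    ... | inj₂ (_ , inj₂ (nle , _ , le)) = ⊥-elim (nle le)

    healthy-waiting-II : ∀ {s s'} → wait s ≡ true → P s s' ⇔ II s s'
    healthy-waiting-II {s} {s'} w = mk⇔ settle (λ e → unheal (inj₁ (lift w , e)))
      where
        settle : P s s' → II s s'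
        settle p with heal p
        ... | inj₁ (_ , e) = e
        ... | inj₂ (nw , _) = ⊥-elim (nw (lift w))

    healthy-active : ∀ t x s' → P ⟪ false , t , x ⟫ s' ⇔
      (t ≼ tr s' × P ⟪ false , ⟨⟩ , x ⟫ (record s' { tr = tr s' - t }))
    healthy-active t x s' = mk⇔ strip
      (λ (le , p) → unheal (inj₂ ((λ ()) , inj₁ (le , p , ⟨⟩-≼ _))))
      where
        strip : P ⟪ false , t , x ⟫ s' →
          t ≼ tr s' × P ⟪ false , ⟨⟩ , x ⟫ (record s' { tr = tr s' - t })
        strip p with heal p
        ... | inj₂ (_ , inj₁ (le , q , _)) = le , q
        ... | inj₂ (_ , inj₂ (nle , _ , le)) = ⊥-elim (nle le)

    healthy-shift-invariant : ∀ t s s' → P (shift t s) (shift t s') ⇔ P s s'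
    healthy-shift-invariant t ⟪ true , u , x ⟫ s' = mk⇔
      (λ p → from (healthy-waiting-II refl) (shift-injective t (to (healthy-waiting-II refl) p)))
      (λ p → from (healthy-waiting-II refl) (cong (shift t) (to (healthy-waiting-II refl) p)))
    healthy-shift-invariant t ⟪ false , u , x ⟫ s' = mk⇔ unshift reshift
      where
        P₀ : Carrier → Set ℓ
        P₀ v = P ⟪ false , ⟨⟩ , x ⟫ (record s' { tr = v })

        unshift : P ⟪ false , t ⌢ u , x ⟫ (shift t s') → P ⟪ false , u , x ⟫ s'
        unshift p with to (healthy-active (t ⌢ u) x (shift t s')) p
        ... | le , q = from (healthy-active u x s')
                         (⌢-cancelˡ-≼ t le , subst P₀ (minus-⌢ˡ t (⌢-cancelˡ-≼ t le)) q)

        reshift : P ⟪ false , u , x ⟫ s' → P ⟪ false , t ⌢ u , x ⟫ (shift t s')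
        reshift p with to (healthy-active u x s') p
        ... | le , q = from (healthy-active (t ⌢ u) x (shift t s'))
                         (⌢-monoʳ-≼ t le , subst P₀ (sym (minus-⌢ˡ t le)) q)

    healthy⇒reactive : IsReactive P
    healthy⇒reactive = record
      { trace-≼ = healthy-trace-≼
      ; shift-invariant = healthy-shift-invariant
      ; waiting-II = healthy-waiting-II
      }

  reactive⇒healthy : ∀ {P} → IsReactive P → Healthy P
  reactive⇒healthy {P} r s s' = R⇒P s s' , P⇒R s s'
    where
      open IsReactive r
      R⇒P : ∀ s s' → R P s s' → P s s'
      R⇒P ⟪ true , _ , _ ⟫ _ (inj₁ (_ , e)) = from (waiting-II refl) e
      R⇒P ⟪ true , _ , _ ⟫ _ (inj₂ (nw , _)) = ⊥-elim (nw (lift refl))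
      R⇒P ⟪ false , _ , _ ⟫ _ (inj₂ (_ , inj₁ (le , p , _))) = from (strip-trace le) p
      R⇒P ⟪ false , _ , _ ⟫ _ (inj₂ (_ , inj₂ (nle , _ , le))) = ⊥-elim (nle le)
      P⇒R : ∀ s s' → P s s' → R P s s'
      P⇒R ⟪ true , _ , _ ⟫ _ p = inj₁ (lift refl , to (waiting-II refl) p)
      P⇒R ⟪ false , _ , _ ⟫ _ p =
        inj₂ ((λ ()) , inj₁ (trace-≼ p , to (strip-trace (trace-≼ p)) p , ⟨⟩-≼ _))

  ⨾-reactive : ∀ {P Q} → IsReactive P → IsReactive Q → IsReactive (P ⨾ Q)
  ⨾-reactive {P} {Q} rP rQ = record
    { trace-≼ = λ (_ , p , q) → ≼-trans (P.trace-≼ p) (Q.trace-≼ q)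
    ; shift-invariant = ⨾-shift-invariant
    ; waiting-II = ⨾-waiting-II
    }
    where
      module P = IsReactive rP
      module Q = IsReactive rQ

      ⨾-shift-invariant : ∀ t s s' → (P ⨾ Q) (shift t s) (shift t s') ⇔ (P ⨾ Q) s s'
      ⨾-shift-invariant t s s' = mk⇔ unshift
        (λ (s₁ , p , q) → shift t s₁ , from (P.shift-invariant t s s₁) p
                                     , from (Q.shift-invariant t s₁ s') q)
        where
          unshift : (P ⨾ Q) (shift t s) (shift t s') → (P ⨾ Q) s s'
          unshift (s₀ , p , q) with shift-surjective s₀ (≼-trans (≼-⌢ t (tr s)) (P.trace-≼ p))
          ... | s₁ , refl = s₁ , to (P.shift-invariant t s s₁) p
                               , to (Q.shift-invariant t s₁ s') q

      ⨾-waiting-II : ∀ {s s'} → wait s ≡ true → (P ⨾ Q) s s' ⇔ II s s'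
      ⨾-waiting-II {s} {s'} w = mk⇔ settle
        (λ { refl → s , from (P.waiting-II w) refl , from (Q.waiting-II w) refl })
        where
          settle : (P ⨾ Q) s s' → II s s'
          settle (_ , p , q) with to (P.waiting-II w) p
          ... | refl = to (Q.waiting-II w) q

theorem13 : {ℓ : Level} (𝕋 : TraceAlgebra ℓ) (S : Set ℓ) →
    let open Designs 𝕋 S in
    (P Q : Pred) → Healthy P → Healthy Q → Healthy (P ⨾ Q)
theorem13 𝕋 S P Q hP hQ =
  reactive⇒healthy (⨾-reactive (healthy⇒reactive hP) (healthy⇒reactive hQ))
  where open Reactive 𝕋 S
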